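{- Let $\langle S,\to\rangle$ be a parallel transaction system over a finite thread set $T$ (as in the context). Let $q_1\to_{\psi(1)}^{+}q_2\to_{\psi(2)}^{+}\cdots\to_{\psi(l)}^{+}q_{l+1}$ be a uts under $T_u=\mathrm{range}(\psi)$ and let $q_{l+1}\to_i q$ be a transition with $i\notin T_u$. Then there exist a transition $q_1\to_i q'$ and a uts $q'=q_1'\to_{\psi(1)}^{+}q_2'\to_{\psi(2)}^{+}\cdots\to_{\psi(l)}^{+}q_{l+1}'$ under $T_u$ such that $q_{l+1}'\cong_{\{i\}}q$.
   Context: Notation: for $X\subseteq S$, $Q\subseteq S\times S$: $X\lhd Q=Q\cap(X\times S)$, $Q\rhd X=Q\cap(S\times X)$, $\overline X=S\setminus X$; for $X\subseteq T$, $\mathcal N_X=\bigcap_{i\in X}\mathcal N_i$. A transition system over $T$ is $\langle S,\to\rangle$ with $\to=\bigcup_{i\in T}\to_i$. A thread bisimulation is an equivalence $R$ on $S$ such that $(\sigma,\sigma')\in R$ and $\sigma\to_i\sigma_1$ imply $\sigma'\to_i\sigma_1'$ for some $\sigma_1'$ with $(\sigma_1,\sigma_1')\in R$. For $A,B\subseteq S\times S$ and equivalence $R$: $A$ right-commutes with $B$ up to $R$ iff whenever $(\sigma_1,\sigma_2)\in A,(\sigma_2,\sigma_3)\in B$ there are $\sigma_4,\sigma_3'$ with $(\sigma_1,\sigma_4)\in B,(\sigma_4,\sigma_3')\in A,(\sigma_3,\sigma_3')\in R$; $A$ left-commutes with $B$ up to $R$ iff whenever $(\sigma_1,\sigma_2)\in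 B,(\sigma_2,\sigma_3)\in A$ there are $\sigma_4,\sigma_3'$ with $(\sigma_1,\sigma_4)\in A,(\sigma_4,\sigma_3')\in B,(\sigma_3,\sigma_3')\in R$. Phase-annotated system: for each $i\in T$ sets $\mathcal R_i,\mathcal L_i,\mathcal N_i$ and a thread bisimulation $\cong_i$ such that for all $i$, $j\ne i$: $S=\mathcal R_i\uplus\mathcal L_i\uplus\mathcal N_i$; $\to_i\cap\to_j=\emptyset$; $\to_i\subseteq\mathcal L_j^2\cup\mathcal R_j^2\cup\mathcal N_j^2$; $\cong_i\subseteq\mathcal L_j^2\cup\mathcal R_j^2\cup\mathcal N_j^2$. For $X\subseteq T$, $\cong_X=(\bigcup_{i\in X}\cong_i)^*$. Parallel transaction system: additionally for all $i$, $j\ne i$: $\mathcal L_i\lhd\to_i\rhd\mathcal R_i=\emptyset$; $\to_i\rhd\mathcal R_i$ right-commutes with $\to_j$ up to $\cong_{\{j\}}$; $\mathcal L_i\lhd\to_i$ left-commutes with $\to_j$ up to $\cong_{\{i,j\}}$; every $\sigma\in\mathcal L_i$ has $\sigma'\in\mathcal N_i$ with $\sigma\to_i^{+}\sigma'$. (Transitions are attributed to threads since the $\to_i$ are pairwise disjoint.) Uncommitted transaction sequence (uts) under $T'\subseteq T$: a path $q_1\to_{\psi(1)}^{+}q_2\cdots\to_{\psi(l)}^{+}q_{l+1}$ ($l\ge0$, $\psi$ a map from indices to threads) where each block is $q_k=q_{k,1}\to_{\psi(k)}\cdots\to_{\psi(k)}q_{k,x_k}=q_{k+1}$, with $\psi(k)\in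 T'$, $q_1\in\mathcal N_{T'}$, $q_{k,1}\in\mathcal N_{\psi(k)}$, and $q_{k,2},\dots,q_{k,x_k}\in\mathcal R_{\psi(k)}$. -}

module Defs where

open import Data.Nat using (ℕ)
open import Data.Fin using (Fin)
open import Data.List using (List; []; _∷_)
open import Data.Product using (Σ; ∃; _×_; _,_)
open import Data.Sum using (_⊎_)
open import Data.Empty using (⊥)
open import Relation.Nullary using (¬_)
open import Relation.Binary.PropositionalEquality using (_≡_)
open import Relation.Binary.Structures using (IsEquivalence)
open import Relation.Binary.Construct.Closure.ReflexiveTransitive using (Star)

Rel₀ : Set → Set₁
Rel₀ S = S → S → Set

Pred₀ : Set → Set₁
Pred₀ S = S → Set

RightCommutes : {S : Set} → Rel₀ S → Rel₀ S → Rel₀ S → Set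
RightCommutes {S} A B R =
  ∀ (σ₁ σ₂ σ₃ : S) → A σ₁ σ₂ → B σ₂ σ₃ →
  Σ S λ σ₄ → Σ S λ σ₃' → B σ₁ σ₄ × A σ₄ σ₃' × R σ₃ σ₃'

LeftCommutes : {S : Set} → Rel₀ S → Rel₀ S → Rel₀ S → Set
LeftCommutes {S} A B R =
  ∀ (σ₁ σ₂ σ₃ : S) → B σ₁ σ₂ → A σ₂ σ₃ →
  Σ S λ σ₄ → Σ S λ σ₃' → A σ₁ σ₄ × B σ₄ σ₃' × R σ₃ σ₃'

_◁_ : {S : Set} → Pred₀ S → Rel₀ S → Rel₀ S
(X ◁ Q) a b = X a × Q a b

_▷_ : {S : Set} → Rel₀ S → Pred₀ S → Rel₀ S
(Q ▷ X) a b = Q a b × X b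

data Plus {S : Set} (Q : Rel₀ S) : Rel₀ S where
  [_]  : ∀ {a b} → Q a b → Plus Q a b
  _∷⁺_ : ∀ {a b c} → Q a b → Plus Q b c → Plus Q a c

IsThreadBisim : {n : ℕ} {S : Set} → (Fin n → Rel₀ S) → Rel₀ S → Set
IsThreadBisim {n} {S} step R =
  IsEquivalence R ×
  (∀ (σ σ' σ₁ : S) (i : Fin n) → R σ σ' → step i σ σ₁ →
     Σ S λ σ₁' → step i σ' σ₁' × R σ₁ σ₁')

Partition3 : {S : Set} → Pred₀ S → Pred₀ S → Pred₀ S → Set
Partition3 {S} P Q U =
  (∀ σ → P σ ⊎ Q σ ⊎ U σ) ×
  (∀ σ → P σ → Q σ → ⊥) × (∀ σ → P σ → U σ → ⊥) × (∀ σ → Q σ → U σ → ⊥)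

Respects3 : {S : Set} → Rel₀ S → Pred₀ S → Pred₀ S → Pred₀ S → Set
Respects3 Q L R N =
  ∀ a b → Q a b → (L a × L b) ⊎ (R a × R b) ⊎ (N a × N b)

CongSet : {n : ℕ} {S : Set} → (Fin n → Rel₀ S) → (Fin n → Set) → Rel₀ S
CongSet {n} cong X = Star (λ a b → Σ (Fin n) λ k → X k × cong k a b)

record PhaseAnnotated (n : ℕ) (S : Set) : Set₁ where
  field
    step : Fin n → Rel₀ S
    Rᵢ Lᵢ Nᵢ : Fin n → Pred₀ S
    cong : Fin n → Rel₀ S
    cong-bisim : ∀ i → IsThreadBisim step (cong i)
    partition : ∀ i → Partition3 (Rᵢ i) (Lᵢ i) (Nᵢ i)
    disjoint : ∀ i j → ¬ (i ≡ j) → ∀ a b → step i a b → step j a b → ⊥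
    step-respects : ∀ i j → ¬ (i ≡ j) → Respects3 (step i) (Lᵢ j) (Rᵢ j) (Nᵢ j)
    cong-respects : ∀ i j → ¬ (i ≡ j) → Respects3 (cong i) (Lᵢ j) (Rᵢ j) (Nᵢ j)

  ≅[_] : (Fin n → Set) → Rel₀ S
  ≅[ X ] = CongSet cong X

record ParallelTransactionSystem (n : ℕ) (S : Set) : Set₁ where
  field
    pa : PhaseAnnotated n S
  open PhaseAnnotated pa public
  field
    no-L→R : ∀ i a b → (Lᵢ i ◁ (step i ▷ Rᵢ i)) a b → ⊥
    right-comm : ∀ i j → ¬ (i ≡ j) →
      RightCommutes (step i ▷ Rᵢ i) (step j) ≅[ (λ k → k ≡ j) ]
    left-comm : ∀ i j → ¬ (i ≡ j) →
      LeftCommutes (Lᵢ i ◁ step i) (step j) ≅[ (λ k → k ≡ i ⊎ k ≡ j) ]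
    L-completes : ∀ i σ → Lᵢ i σ → Σ S λ σ' → Nᵢ i σ' × Plus (step i) σ σ'

module _ {n : ℕ} {S : Set} (P : PhaseAnnotated n S) where
  open PhaseAnnotated P

  data RRun (i : Fin n) : Rel₀ S where
    last : ∀ {a b} → step i a b → Rᵢ i b → RRun i a b
    more : ∀ {a b c} → step i a b → Rᵢ i b → RRun i b c → RRun i a c

  Block : Fin n → Rel₀ S
  Block i a b = Nᵢ i a × RRun i a b

  Blocks : List (Fin n) → Rel₀ S
  Blocks [] a b = a ≡ b
  Blocks (i ∷ ψ) a b = Σ S λ c → Block i a c × Blocks ψ c b

  IsUts : (Fin n → Set) → List (Fin n) → Rel₀ S
  IsUts T' ψ q₁ q =
    (∀ k → k ∈ ψ → T' k) × (∀ k → T' k → Nᵢ k q₁) × Blocks ψ q₁ q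
    where open import Data.List.Membership.Propositional using (_∈_)

-- Every block of the uts is a run of right movers of a thread j ≠ i, so the step of
-- thread i can be commuted leftwards through it one step at a time. Each commutation
-- only holds up to ≅ᵢ, but ≅ᵢ is a thread bisimulation respecting the phases of every
-- j ≠ i, so the remaining runs and blocks can be transported along it; the accumulated
-- ≅ᵢ-discrepancies compose into the single ≅_{i} relating the final states.
module Submission where

open import Defs
open import Data.Nat using (ℕ)
open import Data.Fin using (Fin)
open import Data.List using (List; []; _∷_)
open import Data.List.Membership.Propositional using (_∈_; _∉_)
open import Data.List.Relation.Unary.Any using (here; there)
open import Data.Product using (Σ; ∃-syntax; _×_; _,_; proj₁; proj₂)
open import Data.Sum using (inj₁; inj₂)
open import Data.Empty using (⊥-elim)
open import Function using (_∘_)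
open import Relation.Binary.PropositionalEquality using (_≡_; _≢_; refl; ≢-sym)
open import Relation.Binary.Structures using (IsEquivalence)
open import Relation.Binary.Construct.Closure.ReflexiveTransitive using (Star; ε; _◅_; _◅◅_; reverse)

module _ {S : Set} where

  Simulation : Rel₀ S → Rel₀ S → Set
  Simulation R Q = ∀ {x y b} → R x y → Q x b → ∃[ b' ] Q y b' × R b b'

  star-simulation : {R Q : Rel₀ S} → Simulation R Q → Simulation (Star R) Q
  star-simulation sim ε       qb = _ , qb , ε
  star-simulation sim (r ◅ rs) qb with sim r qb
  ... | b₁ , qb₁ , r₁ with star-simulation sim rs qb₁
  ...   | b₂ , qb₂ , rs₂ = b₂ , qb₂ , r₁ ◅ rs₂

  module _ {ℛ ℒ 𝒩 : Pred₀ S} {Q : Rel₀ S} where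

    respects⇒ℛ-stable : Partition3 ℛ ℒ 𝒩 → Respects3 Q ℒ ℛ 𝒩 → ∀ {x y} → Q x y → ℛ x → ℛ y
    respects⇒ℛ-stable (_ , ℛℒ , ℛ𝒩 , _) resp {x} {y} q ℛx with resp x y q
    ... | inj₁ (ℒx , _)        = ⊥-elim (ℛℒ x ℛx ℒx)
    ... | inj₂ (inj₁ (_ , ℛy)) = ℛy
    ... | inj₂ (inj₂ (𝒩x , _)) = ⊥-elim (ℛ𝒩 x ℛx 𝒩x)

    respects⇒𝒩-stable : Partition3 ℛ ℒ 𝒩 → Respects3 Q ℒ ℛ 𝒩 → ∀ {x y} → Q x y → 𝒩 x → 𝒩 y
    respects⇒𝒩-stable (_ , _ , ℛ𝒩 , ℒ𝒩) resp {x} {y} q 𝒩x with resp x y q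
    ... | inj₁ (ℒx , _)        = ⊥-elim (ℒ𝒩 x ℒx 𝒩x)
    ... | inj₂ (inj₁ (ℛx , _)) = ⊥-elim (ℛ𝒩 x ℛx 𝒩x)
    ... | inj₂ (inj₂ (_ , 𝒩y)) = 𝒩y

module PhaseAnnotatedProperties {n : ℕ} {S : Set} (P : PhaseAnnotated n S) where
  open PhaseAnnotated P

  RespectsPhases : Rel₀ S → Fin n → Set
  RespectsPhases Q j = Respects3 Q (Lᵢ j) (Rᵢ j) (Nᵢ j)

  ≅⟨_⟩ : Fin n → Rel₀ S
  ≅⟨ i ⟩ = ≅[ (λ k → k ≡ i) ]

  ≅⟨⟩-sym : ∀ {i x y} → ≅⟨ i ⟩ x y → ≅⟨ i ⟩ y x
  ≅⟨⟩-sym = reverse λ { (k , k≡i , c) → k , k≡i , IsEquivalence.sym (proj₁ (cong-bisim k)) c }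

  ≅⟨⟩-simulation : ∀ {i Q} → Simulation (cong i) Q → Simulation ≅⟨ i ⟩ Q
  ≅⟨⟩-simulation sim = star-simulation λ { (_ , refl , c) qb →
    let b' , qb' , c' = sim c qb in b' , qb' , _ , refl , c' }

  module _ {R : Rel₀ S} (bisim : IsThreadBisim step R) where

    bisim-simulates-RRun : ∀ {j} → RespectsPhases R j → Simulation R (RRun P j)
    bisim-simulates-RRun resp {x} {y} r (last {b = b} s ℛb) with proj₂ bisim x y b _ r s
    ... | b' , s' , r' = b' , last s' (respects⇒ℛ-stable (partition _) resp r' ℛb) , r'
    bisim-simulates-RRun resp {x} {y} r (more {b = b} s ℛb run) with proj₂ bisim x y b _ r s
    ... | b' , s' , r' with bisim-simulates-RRun resp r' run
    ...   | c' , run' , rc = c' , more s' (respects⇒ℛ-stable (partition _) resp r' ℛb) run' , rc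

    bisim-simulates-Blocks : ∀ {ψ} → (∀ j → j ∈ ψ → RespectsPhases R j) →
                             Simulation R (Blocks P ψ)
    bisim-simulates-Blocks {[]}    resp r refl = _ , refl , r
    bisim-simulates-Blocks {j ∷ ψ} resp r (c , (𝒩x , run) , blocks)
      with bisim-simulates-RRun (resp j (here refl)) r run
    ... | c' , run' , rc with bisim-simulates-Blocks (λ k k∈ψ → resp k (there k∈ψ)) rc blocks
    ...   | b' , blocks' , rb =
      b' , (c' , (respects⇒𝒩-stable (partition j) (resp j (here refl)) r 𝒩x , run') , blocks') , rb

  ≅⟨⟩-simulates-RRun : ∀ {i j} → i ≢ j → Simulation ≅⟨ i ⟩ (RRun P j)
  ≅⟨⟩-simulates-RRun i≢j =
    ≅⟨⟩-simulation (bisim-simulates-RRun (cong-bisim _) (cong-respects _ _ i≢j))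

  ≅⟨⟩-simulates-Blocks : ∀ {i ψ} → i ∉ ψ → Simulation ≅⟨ i ⟩ (Blocks P ψ)
  ≅⟨⟩-simulates-Blocks i∉ψ = ≅⟨⟩-simulation (bisim-simulates-Blocks (cong-bisim _)
    λ { j j∈ψ → cong-respects _ j λ { refl → i∉ψ j∈ψ } })

module ParallelTransactionSystemProperties {n : ℕ} {S : Set} (P : ParallelTransactionSystem n S) where
  open ParallelTransactionSystem P
  open PhaseAnnotatedProperties pa public

  step-preserves-𝒩 : ∀ {i j x y} → i ≢ j → step i x y → Nᵢ j x → Nᵢ j y
  step-preserves-𝒩 i≢j = respects⇒𝒩-stable (partition _) (step-respects _ _ i≢j)

  RRun-right-commutes : ∀ {i j} → i ≢ j → RightCommutes (RRun pa j) (step i) ≅⟨ i ⟩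
  RRun-right-commutes i≢j a c d (last s ℛc) sᵢ
    with right-comm _ _ (≢-sym i≢j) a c d (s , ℛc) sᵢ
  ... | a' , d' , sᵢ' , (s' , ℛd') , d≅d' = a' , d' , sᵢ' , last s' ℛd' , d≅d'
  RRun-right-commutes i≢j a c d (more {b = b} s ℛb run) sᵢ
    with RRun-right-commutes i≢j b c d run sᵢ
  ... | b' , d' , sᵢ' , run' , d≅d'
    with right-comm _ _ (≢-sym i≢j) a b b' (s , ℛb) sᵢ'
  ...   | a' , e , sᵢ'' , (s' , ℛe) , b'≅e
    with ≅⟨⟩-simulates-RRun i≢j b'≅e run'
  ...     | d'' , run'' , d'≅d'' = a' , d'' , sᵢ'' , more s' ℛe run'' , d≅d' ◅◅ d'≅d''

  Blocks-right-commutes : ∀ {i ψ} → i ∉ ψ → RightCommutes (Blocks pa ψ) (step i) ≅⟨ i ⟩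
  Blocks-right-commutes {ψ = []} _ a .a d refl sᵢ = d , d , sᵢ , refl , ε
  Blocks-right-commutes {ψ = _ ∷ ψ} i∉ψ a b d (c , (𝒩a , run) , blocks) sᵢ
    with Blocks-right-commutes (i∉ψ ∘ there) c b d blocks sᵢ
  ... | c' , d' , sᵢ' , blocks' , d≅d'
    with RRun-right-commutes (i∉ψ ∘ here) a c c' run sᵢ'
  ...   | a' , c'' , sᵢ'' , run' , c'≅c''
    with ≅⟨⟩-simulates-Blocks (i∉ψ ∘ there) c'≅c'' blocks'
  ...     | d'' , blocks'' , d'≅d'' =
    a' , d'' , sᵢ'' , (c'' , (step-preserves-𝒩 (i∉ψ ∘ here) sᵢ'' 𝒩a , run') , blocks'') , d≅d' ◅◅ d'≅d''

open ParallelTransactionSystemProperties using (Blocks-right-commutes; step-preserves-𝒩; ≅⟨⟩-sym)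

lemma4 : {n : ℕ} {S : Set} (P : ParallelTransactionSystem n S) →
    let open ParallelTransactionSystem P in
    (ψ : List (Fin n)) (q₁ qₗ₊₁ q : S) (i : Fin n) →
    IsUts pa (λ k → k ∈ ψ) ψ q₁ qₗ₊₁ →
    step i qₗ₊₁ q →
    i ∉ ψ →
    Σ S λ q' → step i q₁ q' ×
    (Σ S λ q'ₗ₊₁ → IsUts pa (λ k → k ∈ ψ) ψ q' q'ₗ₊₁ × ≅[ (λ k → k ≡ i) ] q'ₗ₊₁ q)
lemma4 P ψ q₁ qₗ₊₁ q i (_ , 𝒩q₁ , blocks) sᵢ i∉ψ
  with Blocks-right-commutes P i∉ψ q₁ qₗ₊₁ q blocks sᵢ
... | q' , q'ₗ₊₁ , sᵢ' , blocks' , q≅q'ₗ₊₁ =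
  q' , sᵢ' , q'ₗ₊₁ , ((λ _ k∈ψ → k∈ψ) , 𝒩q' , blocks') , ≅⟨⟩-sym P q≅q'ₗ₊₁
  where
  𝒩q' : ∀ k → k ∈ ψ → ParallelTransactionSystem.Nᵢ P k q'
  𝒩q' k k∈ψ = step-preserves-𝒩 P (λ { refl → i∉ψ k∈ψ }) sᵢ' (𝒩q₁ k k∈ψ)
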